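{- If $M=(E,\mathcal{B})$ is an antisymmetric matroid on $E=[n]\cup[n]^*$, then $(E,\mathcal{B}\cap\mathcal{T}_n)$ is a symmetric matroid.
   Context: $E=[n]\cup[n]^*$ with involution $i\leftrightarrow i^*$; a skew pair is $\{i,i^*\}$; $\mathcal{T}_n$ (transversals) are $n$-subsets of $E$ with no skew pair, $\mathcal{A}_n$ (almost-transversals) $n$-subsets with exactly one skew pair. An antisymmetric matroid on $E$ is $(E,\mathcal{B})$ with $\mathcal{B}\subseteq\mathcal{T}_n\cup\mathcal{A}_n$ satisfying (B1) $\mathcal{B}\ne\emptyset$; (B2) for $T\in\mathcal{T}_n$ and distinct skew pairs $p,q$, $(T\cup p)\setminus q\in\mathcal{B}$ iff $(T\cup q)\setminus p\in\mathcal{B}$; (Exch) for $B,B'\in\mathcal{B}$ and $e\in B\setminus B'$ with $B\setminus\{e\}$ having no skew pair and $B'\cup\{e\}$ having exactly one skew pair, there is $f\in B'\setminus B$ with both $(B\setminus\{e\})\cup\{f\}$ and $(B'\cup\{e\})\setminus\{f\}$ in $\mathcal{B}$. A symmetric matroid is a pair $(E,\mathcal{B}')$ with $\emptyset\ne\mathcal{B}'\subseteq\mathcal{T}_n$ such that for all $B_1,B_2\in\mathcal{B}'$ and $x\in B_1\setminus B_2$ there is $y\in B_1\setminus B_2$ (possibly $y=x$) with $B_1\triangle\{x,x^*,y,y^*\}\in\mathcal{B}'$. -}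

module Defs where

open import Data.Nat using (ℕ; _+_)
open import Data.Bool using (Bool; true; false)
open import Data.Fin using (Fin)
open import Data.Fin.Subset as S using (Subset)
import Data.Sum
open import Data.Product using (_×_; _,_; Σ; ∃)
open import Relation.Binary.PropositionalEquality using (_≡_; _≢_)
open import Relation.Nullary using (¬_)
open import Function.Bundles using (_⇔_)

-- The ground set E = [n] ∪ [n]* : an element is (i , false) = i or (i , true) = i*.
Elem : ℕ → Set
Elem n = Fin n × Bool

-- A subset X of E is stored as (X ∩ [n] , X ∩ [n]*), each as a subset of Fin n.
SubE : ℕ → Set
SubE n = Subset n × Subset n

module _ {n : ℕ} where

  _∈E_ : Elem n → SubE n → Set
  (i , false) ∈E (P , S) = i S.∈ P
  (i , true)  ∈E (P , S) = i S.∈ S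

  _∉E_ : Elem n → SubE n → Set
  e ∉E X = ¬ (e ∈E X)

  _∪E_ : SubE n → SubE n → SubE n
  (P , S) ∪E (P' , S') = (P S.∪ P') , (S S.∪ S')

  _∖E_ : SubE n → SubE n → SubE n
  (P , S) ∖E (P' , S') = (P S.─ P') , (S S.─ S')

  _△E_ : SubE n → SubE n → SubE n
  X △E Y = (X ∖E Y) ∪E (Y ∖E X)

  ⁅_⁆E : Elem n → SubE n
  ⁅ (i , false) ⁆E = S.⁅ i ⁆ , S.⊥
  ⁅ (i , true)  ⁆E = S.⊥ , S.⁅ i ⁆

  skew : Fin n → SubE n
  skew i = S.⁅ i ⁆ , S.⁅ i ⁆

  idx : Elem n → Fin n
  idx (i , _) = i

  card : SubE n → ℕ
  card (P , S) = S.∣ P ∣ + S.∣ S ∣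

  nSkew : SubE n → ℕ
  nSkew (P , S) = S.∣ P S.∩ S ∣

  IsTransversal : SubE n → Set
  IsTransversal X = card X ≡ n × nSkew X ≡ 0

  IsAlmostTransversal : SubE n → Set
  IsAlmostTransversal X = card X ≡ n × nSkew X ≡ 1

record IsAntisymmetricMatroid (n : ℕ) (ℬ : SubE n → Set) : Set₁ where
  field
    ⊆𝒯∪𝒜 : ∀ B → ℬ B → (IsTransversal B Data.Sum.⊎ IsAlmostTransversal B)
    B1 : ∃ λ B → ℬ B
    B2 : ∀ T → IsTransversal T → ∀ (p q : Fin n) → p ≢ q →
         ℬ ((T ∪E skew p) ∖E skew q) ⇔ ℬ ((T ∪E skew q) ∖E skew p)
    Exch : ∀ B B' (e : Elem n) → ℬ B → ℬ B' → e ∈E B → e ∉E B' →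
           nSkew (B ∖E ⁅ e ⁆E) ≡ 0 → nSkew (B' ∪E ⁅ e ⁆E) ≡ 1 →
           Σ (Elem n) λ f → f ∈E B' × f ∉E B ×
             ℬ ((B ∖E ⁅ e ⁆E) ∪E ⁅ f ⁆E) × ℬ ((B' ∪E ⁅ e ⁆E) ∖E ⁅ f ⁆E)

record IsSymmetricMatroid (n : ℕ) (ℬ' : SubE n → Set) : Set₁ where
  field
    ⊆𝒯 : ∀ B → ℬ' B → IsTransversal B
    nonempty : ∃ λ B → ℬ' B
    exch : ∀ B₁ B₂ (x : Elem n) → ℬ' B₁ → ℬ' B₂ → x ∈E B₁ → x ∉E B₂ →
           Σ (Elem n) λ y → y ∈E B₁ × y ∉E B₂ ×
             ℬ' (B₁ △E (skew (idx x) ∪E skew (idx y)))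

_∩𝒯 : {n : ℕ} → (SubE n → Set) → (SubE n → Set)
(ℬ ∩𝒯) X = ℬ X × IsTransversal X

{-# OPTIONS --safe #-}
module Submission where

-- Over each index k a subset of E meets the skew pair {k , k*} in a fiber: ∅, {k}, {k*} or {k , k*}.
-- Counting shows that the transversals are exactly the sets T_σ = {(k , σ k)} of sign vectors σ, and
-- the almost-transversals exactly the sets (T_σ ∪ {p , p*}) ∖ {q , q*} with p ≠ q, the shape of (B2).
--
-- Swap step: if A = (T_σ ∪ {p , p*}) ∖ {q , q*} is a basis, then so is A′ = (T_σ ∪ {q , q*}) ∖ {p , p*}
-- by (B2). Exchanging (p , σ p) ∈ A ∖ A′ returns an element of A′ ∖ A, which lies over q, and the new
-- basis is T_σ with its sign flipped at p, and possibly also at q. So T_σ △ ({p , p*} ∪ {r , r*}) is a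
-- basis for some r ∈ {p , q}; in particular an almost-transversal basis yields a transversal one.
--
-- Symmetric exchange: let B₁ = T_σ and B₂ be transversal bases and x = (i , σ i) ∉ B₂. Exchanging x
-- from B₁ into B₂ returns some f ∈ B₂ ∖ B₁. If f = x*, then B₁ △ {i , i*} is a basis. Otherwise f lies
-- over some j ≠ i and (B₁ − x) + f = (T_σ ∪ {j , j*}) ∖ {i , i*}; after (B2) the swap step gives a basis
-- B₁ △ ({i , i*} ∪ {r , r*}) with r ∈ {i , j}, and in either case (r , σ r) ∉ B₂.

open import Defs
open import Data.Nat using (ℕ; suc; _+_; _∸_)
open import Data.Nat.Properties using (+-suc; suc-injective; m+n∸m≡n; +-identityʳ)
open import Data.Bool using (Bool; true; false; not; _∧_; _∨_)
import Data.Bool as Bool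
open import Data.Bool.Properties using (∧-identityʳ; ∧-zeroʳ; ∨-inverseˡ; ∧-inverseˡ; ¬-not; not-¬)
open import Data.Fin using (Fin; zero; suc; _≟_)
open import Data.Fin.Subset using (Subset; ∣_∣; _∪_; _∩_; _─_; ∁; ⁅_⁆; ⊥; ⊤)
open import Data.Fin.Subset.Properties using (∣p∣≡n⇒p≡⊤; ∣∁p∣≡n∸∣p∣; ∣⊥∣≡0; ∣⊤∣≡n; ∣⁅x⁆∣≡1)
open import Data.Vec using (Vec; []; _∷_; lookup; tabulate)
open import Data.Vec.Properties
  using (lookup-zipWith; lookup-map; lookup-replicate; lookup∘tabulate; tabulate∘lookup; tabulate-cong;
         []=⇒lookup; lookup⇒[]=)
open import Data.Product using (_×_; _,_; Σ; ∃; ∃₂; proj₁; proj₂)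
open import Data.Sum using (_⊎_; inj₁; inj₂; [_,_])
open import Data.Empty using (⊥-elim)
open import Function.Base using (_∘_)
open import Function.Bundles using (_⇔_; mk⇔; Equivalence)
open import Relation.Nullary using (does; yes; no)
open import Relation.Nullary.Decidable using (dec-true)
open import Relation.Binary.PropositionalEquality
  using (_≡_; _≢_; refl; sym; trans; cong; cong₂; subst; module ≡-Reasoning)

∣p∣+∣q∣≡∣p∪q∣+∣p∩q∣ : ∀ {n} (p q : Subset n) → ∣ p ∣ + ∣ q ∣ ≡ ∣ p ∪ q ∣ + ∣ p ∩ q ∣
∣p∣+∣q∣≡∣p∪q∣+∣p∩q∣ []          []          = refl
∣p∣+∣q∣≡∣p∪q∣+∣p∩q∣ (true ∷ p)  (true ∷ q)  = begin
  suc (∣ p ∣ + suc ∣ q ∣)             ≡⟨ cong suc (+-suc ∣ p ∣ ∣ q ∣) ⟩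
  2 + (∣ p ∣ + ∣ q ∣)                 ≡⟨ cong (2 +_) (∣p∣+∣q∣≡∣p∪q∣+∣p∩q∣ p q) ⟩
  2 + (∣ p ∪ q ∣ + ∣ p ∩ q ∣)         ≡⟨ cong suc (+-suc ∣ p ∪ q ∣ ∣ p ∩ q ∣) ⟨
  suc (∣ p ∪ q ∣ + suc ∣ p ∩ q ∣)     ∎
  where open ≡-Reasoning
∣p∣+∣q∣≡∣p∪q∣+∣p∩q∣ (true ∷ p)  (false ∷ q) = cong suc (∣p∣+∣q∣≡∣p∪q∣+∣p∩q∣ p q)
∣p∣+∣q∣≡∣p∪q∣+∣p∩q∣ (false ∷ p) (true ∷ q)  =
  trans (+-suc ∣ p ∣ ∣ q ∣) (cong suc (∣p∣+∣q∣≡∣p∪q∣+∣p∩q∣ p q))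
∣p∣+∣q∣≡∣p∪q∣+∣p∩q∣ (false ∷ p) (false ∷ q) = ∣p∣+∣q∣≡∣p∪q∣+∣p∩q∣ p q

∣p∣≡0⇒p≡⊥ : ∀ {n} {p : Subset n} → ∣ p ∣ ≡ 0 → p ≡ ⊥
∣p∣≡0⇒p≡⊥ {p = []}        _     = refl
∣p∣≡0⇒p≡⊥ {p = false ∷ p} ∣p∣≡0 = cong (false ∷_) (∣p∣≡0⇒p≡⊥ ∣p∣≡0)

∣p∣≡1⇒p≡⁅x⁆ : ∀ {n} {p : Subset n} → ∣ p ∣ ≡ 1 → ∃ λ x → p ≡ ⁅ x ⁆
∣p∣≡1⇒p≡⁅x⁆ {p = true ∷ p}  ∣p∣≡1 = zero , cong (true ∷_) (∣p∣≡0⇒p≡⊥ (suc-injective ∣p∣≡1))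
∣p∣≡1⇒p≡⁅x⁆ {p = false ∷ p} ∣p∣≡1 =
  let (x , p≡⁅x⁆) = ∣p∣≡1⇒p≡⁅x⁆ ∣p∣≡1 in suc x , cong (false ∷_) p≡⁅x⁆

lookup-⁅⁆ : ∀ {n} (i k : Fin n) → lookup ⁅ i ⁆ k ≡ does (k ≟ i)
lookup-⁅⁆ zero    zero    = refl
lookup-⁅⁆ zero    (suc k) = lookup-replicate k false
lookup-⁅⁆ (suc i) zero    = refl
lookup-⁅⁆ (suc i) (suc k) = lookup-⁅⁆ i k

lookup-─ : ∀ {n} (p q : Subset n) k → lookup (p ─ q) k ≡ lookup p k ∧ not (lookup q k)
lookup-─ (x ∷ p) (true  ∷ q) zero    = sym (∧-zeroʳ x)
lookup-─ (x ∷ p) (false ∷ q) zero    = sym (∧-identityʳ x)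
lookup-─ (_ ∷ p) (_     ∷ q) (suc k) = lookup-─ p q k

lookup-injective : ∀ {A : Set} {n} {u v : Vec A n} → (∀ k → lookup u k ≡ lookup v k) → u ≡ v
lookup-injective {u = u} {v} u≗v = begin
  u                   ≡⟨ tabulate∘lookup u ⟨
  tabulate (lookup u) ≡⟨ tabulate-cong u≗v ⟩
  tabulate (lookup v) ≡⟨ tabulate∘lookup v ⟩
  v                   ∎
  where open ≡-Reasoning

-- The fiber of X over k is the pair (k ∈ X , k* ∈ X).
Fiber : Set
Fiber = Bool × Bool

infixl 6 _∪ᶠ_ _∖ᶠ_

_∪ᶠ_ : Fiber → Fiber → Fiber
(x , y) ∪ᶠ (x′ , y′) = x ∨ x′ , y ∨ y′

_∖ᶠ_ : Fiber → Fiber → Fiber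
(x , y) ∖ᶠ (x′ , y′) = x ∧ not x′ , y ∧ not y′

full : Fiber → Bool
full (x , y) = x ∧ y

_∈ᶠ_ : Bool → Fiber → Bool
false ∈ᶠ (x , _) = x
true  ∈ᶠ (_ , y) = y

Complementary : Fiber → Set
Complementary (x , y) = x ≡ not y

module _ {n : ℕ} where

  fiber : SubE n → Fin n → Fiber
  fiber (P , S) k = lookup P k , lookup S k

  fiber-injective : ∀ {X Y : SubE n} → (∀ k → fiber X k ≡ fiber Y k) → X ≡ Y
  fiber-injective X≗Y =
    cong₂ _,_ (lookup-injective (cong proj₁ ∘ X≗Y)) (lookup-injective (cong proj₂ ∘ X≗Y))

  ∈E⇔∈ᶠ : ∀ {X : SubE n} {k d} → (k , d) ∈E X ⇔ (d ∈ᶠ fiber X k ≡ true)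
  ∈E⇔∈ᶠ {P , S} {k} {false} = mk⇔ []=⇒lookup (lookup⇒[]= k P)
  ∈E⇔∈ᶠ {P , S} {k} {true}  = mk⇔ []=⇒lookup (lookup⇒[]= k S)

  fiber-∪E : ∀ (X Y : SubE n) k → fiber (X ∪E Y) k ≡ fiber X k ∪ᶠ fiber Y k
  fiber-∪E (P , S) (P′ , S′) k = cong₂ _,_ (lookup-zipWith _∨_ k P P′) (lookup-zipWith _∨_ k S S′)

  fiber-∖E : ∀ (X Y : SubE n) k → fiber (X ∖E Y) k ≡ fiber X k ∖ᶠ fiber Y k
  fiber-∖E (P , S) (P′ , S′) k = cong₂ _,_ (lookup-─ P P′ k) (lookup-─ S S′ k)

  lookup-∩-fiber : ∀ (X : SubE n) k → lookup (proj₁ X ∩ proj₂ X) k ≡ full (fiber X k)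
  lookup-∩-fiber (P , S) k = lookup-zipWith _∧_ k P S

  nSkew≡0 : ∀ {X : SubE n} → (∀ k → full (fiber X k) ≡ false) → nSkew X ≡ 0
  nSkew≡0 {X} noFull = trans (cong ∣_∣ skews≡⊥) (∣⊥∣≡0 n)
    where
    skews≡⊥ : proj₁ X ∩ proj₂ X ≡ ⊥
    skews≡⊥ = lookup-injective λ k →
      trans (lookup-∩-fiber X k) (trans (noFull k) (sym (lookup-replicate k false)))

  nSkew≡1 : ∀ {X : SubE n} q → (∀ k → full (fiber X k) ≡ does (k ≟ q)) → nSkew X ≡ 1
  nSkew≡1 {X} q fullAt = trans (cong ∣_∣ skews≡⁅q⁆) (∣⁅x⁆∣≡1 q)
    where
    skews≡⁅q⁆ : proj₁ X ∩ proj₂ X ≡ ⁅ q ⁆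
    skews≡⁅q⁆ = lookup-injective λ k →
      trans (lookup-∩-fiber X k) (trans (fullAt k) (sym (lookup-⁅⁆ q k)))

  transversal⇒complementary : ∀ {X : SubE n} → IsTransversal X → ∀ k → Complementary (fiber X k)
  transversal⇒complementary {P , S} (card≡n , nSkew≡0) k =
    complementary (trans (sym (lookup-zipWith _∨_ k P S)) (trans (lookup-at ∪≡⊤) (lookup-replicate k true)))
                  (trans (sym (lookup-zipWith _∧_ k P S)) (trans (lookup-at ∩≡⊥) (lookup-replicate k false)))
    where
    complementary : ∀ {x y} → x ∨ y ≡ true → x ∧ y ≡ false → x ≡ not y
    complementary {true}  {false} _ _ = refl
    complementary {false} {true}  _ _ = refl
    complementary {true}  {true}  _ ()
    complementary {false} {false} () _
    lookup-at : ∀ {u v : Subset n} → u ≡ v → lookup u k ≡ lookup v k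
    lookup-at = cong (λ w → lookup w k)
    ∣∪∣≡n : ∣ P ∪ S ∣ ≡ n
    ∣∪∣≡n = begin
      ∣ P ∪ S ∣               ≡⟨ +-identityʳ _ ⟨
      ∣ P ∪ S ∣ + 0           ≡⟨ cong (∣ P ∪ S ∣ +_) nSkew≡0 ⟨
      ∣ P ∪ S ∣ + ∣ P ∩ S ∣   ≡⟨ ∣p∣+∣q∣≡∣p∪q∣+∣p∩q∣ P S ⟨
      ∣ P ∣ + ∣ S ∣           ≡⟨ card≡n ⟩
      n                       ∎
      where open ≡-Reasoning
    ∪≡⊤ : P ∪ S ≡ ⊤
    ∪≡⊤ = ∣p∣≡n⇒p≡⊤ ∣∪∣≡n
    ∩≡⊥ : P ∩ S ≡ ⊥
    ∩≡⊥ = ∣p∣≡0⇒p≡⊥ nSkew≡0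

  complementary⇒transversal : ∀ {X : SubE n} → (∀ k → Complementary (fiber X k)) → IsTransversal X
  complementary⇒transversal {P , S} comp = card≡n , nSkew≡0 {P , S} noFull
    where
    noFull : ∀ k → lookup P k ∧ lookup S k ≡ false
    noFull k = trans (cong (_∧ lookup S k) (comp k)) (∧-inverseˡ (lookup S k))
    ∪≡⊤ : P ∪ S ≡ ⊤
    ∪≡⊤ = lookup-injective λ k → begin
      lookup (P ∪ S) k              ≡⟨ lookup-zipWith _∨_ k P S ⟩
      lookup P k ∨ lookup S k       ≡⟨ cong (_∨ lookup S k) (comp k) ⟩
      not (lookup S k) ∨ lookup S k ≡⟨ ∨-inverseˡ (lookup S k) ⟩
      true                          ≡⟨ lookup-replicate k true ⟨
      lookup ⊤ k                    ∎
      where open ≡-Reasoning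
    card≡n : ∣ P ∣ + ∣ S ∣ ≡ n
    card≡n = begin
      ∣ P ∣ + ∣ S ∣           ≡⟨ ∣p∣+∣q∣≡∣p∪q∣+∣p∩q∣ P S ⟩
      ∣ P ∪ S ∣ + ∣ P ∩ S ∣   ≡⟨ cong₂ _+_ (cong ∣_∣ ∪≡⊤) (nSkew≡0 {P , S} noFull) ⟩
      ∣ ⊤ {n} ∣ + 0           ≡⟨ +-identityʳ _ ⟩
      ∣ ⊤ {n} ∣               ≡⟨ ∣⊤∣≡n n ⟩
      n                       ∎
      where open ≡-Reasoning

  almostTransversal⇒fibers : ∀ {X : SubE n} → IsAlmostTransversal X →
    ∃₂ λ p q → (∀ k → full (fiber X k) ≡ does (k ≟ p)) ×
               (∀ k → not (proj₁ (fiber X k) ∨ proj₂ (fiber X k)) ≡ does (k ≟ q))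
  almostTransversal⇒fibers {P , S} (card≡n , nSkew≡1) =
    let (p , ∩≡⁅p⁆) = ∣p∣≡1⇒p≡⁅x⁆ {p = P ∩ S} nSkew≡1
        (q , ∁∪≡⁅q⁆) = ∣p∣≡1⇒p≡⁅x⁆ {p = ∁ (P ∪ S)} ∣∁∪∣≡1
    in p , q
     , (λ k → trans (sym (lookup-zipWith _∧_ k P S)) (lookup-⁅⁆-≡ k ∩≡⁅p⁆))
     , (λ k → trans (sym (lookup-∁∪ k)) (lookup-⁅⁆-≡ k ∁∪≡⁅q⁆))
    where
    lookup-⁅⁆-≡ : ∀ {u : Subset n} {i} k → u ≡ ⁅ i ⁆ → lookup u k ≡ does (k ≟ i)
    lookup-⁅⁆-≡ {i = i} k refl = lookup-⁅⁆ i k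
    lookup-∁∪ : ∀ k → lookup (∁ (P ∪ S)) k ≡ not (lookup P k ∨ lookup S k)
    lookup-∁∪ k = trans (lookup-map k not (P ∪ S)) (cong not (lookup-zipWith _∨_ k P S))
    ∣∁∪∣≡1 : ∣ ∁ (P ∪ S) ∣ ≡ 1
    ∣∁∪∣≡1 = begin
      ∣ ∁ (P ∪ S) ∣                       ≡⟨ ∣∁p∣≡n∸∣p∣ (P ∪ S) ⟩
      n ∸ ∣ P ∪ S ∣                       ≡⟨ cong (_∸ ∣ P ∪ S ∣) card≡n ⟨
      (∣ P ∣ + ∣ S ∣) ∸ ∣ P ∪ S ∣         ≡⟨ cong (_∸ ∣ P ∪ S ∣) (∣p∣+∣q∣≡∣p∪q∣+∣p∩q∣ P S) ⟩
      (∣ P ∪ S ∣ + ∣ P ∩ S ∣) ∸ ∣ P ∪ S ∣ ≡⟨ m+n∸m≡n ∣ P ∪ S ∣ ∣ P ∩ S ∣ ⟩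
      ∣ P ∩ S ∣                           ≡⟨ nSkew≡1 ⟩
      1                                   ∎
      where open ≡-Reasoning

-- Every set occurring in the argument is built from one transversal (signed σ, containing (k , σ k))
-- by unions and differences with singletons and skew pairs. Such expressions are evaluated fiberwise by
-- _at_, so an identity between them holds by computation once k has been compared with the indices it
-- mentions and the sign of σ at k has been fixed.
infixl 8 _∪ᵉ_ _∖ᵉ_

data SetExpr (n : ℕ) : Set where
  signed    : (Fin n → Bool) → SetExpr n
  ⁅_⁆ᵉ      : Elem n → SetExpr n
  skewᵉ     : Fin n → SetExpr n
  _∪ᵉ_ _∖ᵉ_ : SetExpr n → SetExpr n → SetExpr n

module _ {n : ℕ} where

  infixl 8 _△ᵉ_
  infix  7 _at_
  infix  4 _≐_

  _△ᵉ_ : SetExpr n → SetExpr n → SetExpr n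
  a △ᵉ b = (a ∖ᵉ b) ∪ᵉ (b ∖ᵉ a)

  almost : (Fin n → Bool) → Fin n → Fin n → SetExpr n
  almost σ p q = (signed σ ∪ᵉ skewᵉ p) ∖ᵉ skewᵉ q

  ⟦_⟧ : SetExpr n → SubE n
  ⟦ signed σ ⟧ = tabulate (not ∘ σ) , tabulate σ
  ⟦ ⁅ e ⁆ᵉ ⟧   = ⁅ e ⁆E
  ⟦ skewᵉ i ⟧  = skew i
  ⟦ a ∪ᵉ b ⟧   = ⟦ a ⟧ ∪E ⟦ b ⟧
  ⟦ a ∖ᵉ b ⟧   = ⟦ a ⟧ ∖E ⟦ b ⟧

  -- The index test comes first, so a singleton has fiber (false , false) away from its index
  -- whatever its sign.
  _at_ : SetExpr n → Fin n → Fiber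
  signed σ   at k = not (σ k) , σ k
  ⁅ i , b ⁆ᵉ at k = does (k ≟ i) ∧ not b , does (k ≟ i) ∧ b
  skewᵉ i    at k = does (k ≟ i) , does (k ≟ i)
  (a ∪ᵉ b)   at k = a at k ∪ᶠ b at k
  (a ∖ᵉ b)   at k = a at k ∖ᶠ b at k

  fiber-⟦⟧ : ∀ a k → fiber ⟦ a ⟧ k ≡ a at k
  fiber-⟦⟧ (signed σ)     k = cong₂ _,_ (lookup∘tabulate (not ∘ σ) k) (lookup∘tabulate σ k)
  fiber-⟦⟧ ⁅ i , false ⁆ᵉ k = cong₂ _,_ (trans (lookup-⁅⁆ i k) (sym (∧-identityʳ _)))
                                       (trans (lookup-replicate k false) (sym (∧-zeroʳ _)))
  fiber-⟦⟧ ⁅ i , true ⁆ᵉ  k = cong₂ _,_ (trans (lookup-replicate k false) (sym (∧-zeroʳ _)))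
                                       (trans (lookup-⁅⁆ i k) (sym (∧-identityʳ _)))
  fiber-⟦⟧ (skewᵉ i)      k = cong₂ _,_ (lookup-⁅⁆ i k) (lookup-⁅⁆ i k)
  fiber-⟦⟧ (a ∪ᵉ b)       k = trans (fiber-∪E ⟦ a ⟧ ⟦ b ⟧ k) (cong₂ _∪ᶠ_ (fiber-⟦⟧ a k) (fiber-⟦⟧ b k))
  fiber-⟦⟧ (a ∖ᵉ b)       k = trans (fiber-∖E ⟦ a ⟧ ⟦ b ⟧ k) (cong₂ _∖ᶠ_ (fiber-⟦⟧ a k) (fiber-⟦⟧ b k))

  -- Records, so that the expressions can be inferred from a proof (_at_ is not injective).
  record _≐_ (a b : SetExpr n) : Set where
    field same-fiber : ∀ k → a at k ≡ b at k
  open _≐_ public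

  record Fiberwise (P : Fin n → Fiber → Set) (a : SetExpr n) : Set where
    field fiberwise : ∀ k → P k (a at k)
  open Fiberwise public

  SkewFree : SetExpr n → Set
  SkewFree = Fiberwise λ _ f → full f ≡ false

  OnlySkewAt : Fin n → SetExpr n → Set
  OnlySkewAt q = Fiberwise λ k f → full f ≡ does (k ≟ q)

  TransversalFibers : SetExpr n → Set
  TransversalFibers = Fiberwise λ _ → Complementary

  ⟦⟧-≡ : ∀ {a b} → a ≐ b → ⟦ a ⟧ ≡ ⟦ b ⟧
  ⟦⟧-≡ {a} {b} a≐b = fiber-injective λ k →
    trans (fiber-⟦⟧ a k) (trans (same-fiber a≐b k) (sym (fiber-⟦⟧ b k)))

  ∈⟦⟧⇔ : ∀ a {k d} → (k , d) ∈E ⟦ a ⟧ ⇔ (d ∈ᶠ (a at k) ≡ true)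
  ∈⟦⟧⇔ a {k} {d} = mk⇔ (λ k∈ → trans (sym fiber≡) (Equivalence.to ∈E⇔∈ᶠ k∈))
                       (λ h → Equivalence.from ∈E⇔∈ᶠ (trans fiber≡ h))
    where
    fiber≡ : d ∈ᶠ fiber ⟦ a ⟧ k ≡ d ∈ᶠ (a at k)
    fiber≡ = cong (d ∈ᶠ_) (fiber-⟦⟧ a k)

  nSkew⟦⟧≡0 : ∀ {a} → SkewFree a → nSkew ⟦ a ⟧ ≡ 0
  nSkew⟦⟧≡0 {a} noFull =
    nSkew≡0 {X = ⟦ a ⟧} λ k → trans (cong full (fiber-⟦⟧ a k)) (fiberwise noFull k)

  nSkew⟦⟧≡1 : ∀ {a} q → OnlySkewAt q a → nSkew ⟦ a ⟧ ≡ 1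
  nSkew⟦⟧≡1 {a} q fullAt =
    nSkew≡1 {X = ⟦ a ⟧} q λ k → trans (cong full (fiber-⟦⟧ a k)) (fiberwise fullAt k)

  transversal⟦⟧ : ∀ {a} → TransversalFibers a → IsTransversal ⟦ a ⟧
  transversal⟦⟧ {a} comp = complementary⇒transversal {X = ⟦ a ⟧} λ k →
    subst Complementary (sym (fiber-⟦⟧ a k)) (fiberwise comp k)

  signed-transversal : ∀ σ → IsTransversal ⟦ signed σ ⟧
  signed-transversal σ = transversal⟦⟧ {a = signed σ} λ where .fiberwise k → refl

  ∈-signed : ∀ {σ k d} → (k , d) ∈E ⟦ signed σ ⟧ ⇔ (d ≡ σ k)
  ∈-signed {σ} {k} {d} = mk⇔ (to d (σ k) ∘ Equivalence.to (∈⟦⟧⇔ (signed σ)))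
                             (Equivalence.from (∈⟦⟧⇔ (signed σ)) ∘ from d (σ k))
    where
    to : ∀ d s → d ∈ᶠ (not s , s) ≡ true → d ≡ s
    to false false _ = refl
    to true  true  _ = refl
    from : ∀ d s → d ≡ s → d ∈ᶠ (not s , s) ≡ true
    from false false _ = refl
    from true  true  _ = refl

  transversal⇒signed : ∀ {X : SubE n} → IsTransversal X → ∃ λ σ → X ≡ ⟦ signed σ ⟧
  transversal⇒signed {X} isT = proj₂ ∘ fiber X , fiber-injective λ k →
    trans (cong (_, proj₂ (fiber X k)) (transversal⇒complementary {X = X} isT k))
          (sym (fiber-⟦⟧ (signed _) k))

  almostTransversal⇒almost : ∀ {X : SubE n} → IsAlmostTransversal X →
                             ∃ λ σ → ∃₂ λ p q → p ≢ q × X ≡ ⟦ almost σ p q ⟧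
  almostTransversal⇒almost {X} isA =
    let (p , q , fullAt , emptyAt) = almostTransversal⇒fibers {X = X} isA
    in proj₂ ∘ fiber X , p , q , p≢q fullAt emptyAt
     , fiber-injective λ k →
         trans (shape (sym (fullAt k)) (sym (emptyAt k))) (sym (fiber-⟦⟧ (almost _ p q) k))
    where
    shape : ∀ {x y a b} → a ≡ x ∧ y → b ≡ not (x ∨ y) → (x , y) ≡ ((not y , y) ∪ᶠ (a , a)) ∖ᶠ (b , b)
    shape {true}  {true}  refl refl = refl
    shape {true}  {false} refl refl = refl
    shape {false} {true}  refl refl = refl
    shape {false} {false} refl refl = refl
    not-full-and-empty : ∀ ((x , y) : Fiber) → full (x , y) ≡ true → not (x ∨ y) ≢ true
    not-full-and-empty (true  , true)  _  ()
    not-full-and-empty (true  , false) ()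
    not-full-and-empty (false , _)     ()
    p≢q : ∀ {p q} → (∀ k → full (fiber X k) ≡ does (k ≟ p)) →
          (∀ k → not (proj₁ (fiber X k) ∨ proj₂ (fiber X k)) ≡ does (k ≟ q)) → p ≢ q
    p≢q {p} fullAt emptyAt refl =
      not-full-and-empty (fiber X p) (trans (fullAt p) p≟p) (trans (emptyAt p) p≟p)
      where
      p≟p : does (p ≟ p) ≡ true
      p≟p = dec-true (p ≟ p) refl

module _ {n : ℕ} (σ : Fin n → Bool) where

  flip-transversal : ∀ i j → TransversalFibers (signed σ △ᵉ (skewᵉ i ∪ᵉ skewᵉ j))
  flip-transversal i j .fiberwise k with does (k ≟ i) ∨ does (k ≟ j) | σ k
  ... | true  | true  = refl
  ... | true  | false = refl
  ... | false | true  = refl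
  ... | false | false = refl

  signed-∖-skewFree : ∀ i → SkewFree (signed σ ∖ᵉ ⁅ i , σ i ⁆ᵉ)
  signed-∖-skewFree i .fiberwise k with k ≟ i
  ... | yes refl with σ i
  ...   | true  = refl
  ...   | false = refl
  signed-∖-skewFree i .fiberwise k | no _ with σ k
  ...   | true  = refl
  ...   | false = refl

  signed-∪-onlySkew : ∀ {i b} → b ≢ σ i → OnlySkewAt i (signed σ ∪ᵉ ⁅ i , b ⁆ᵉ)
  signed-∪-onlySkew {i} b≢σi .fiberwise k with refl ← ¬-not b≢σi | k ≟ i
  ... | yes refl with σ i
  ...   | true  = refl
  ...   | false = refl
  signed-∪-onlySkew b≢σi .fiberwise k | no _ with σ k
  ...   | true  = refl
  ...   | false = refl

  signed-replace-partner : ∀ i →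
    (signed σ ∖ᵉ ⁅ i , σ i ⁆ᵉ) ∪ᵉ ⁅ i , not (σ i) ⁆ᵉ ≐ signed σ △ᵉ (skewᵉ i ∪ᵉ skewᵉ i)
  signed-replace-partner i .same-fiber k with k ≟ i
  ... | yes refl with σ i
  ...   | true  = refl
  ...   | false = refl
  signed-replace-partner i .same-fiber k | no _ with σ k
  ...   | true  = refl
  ...   | false = refl

  signed-replace-other : ∀ {i j} → j ≢ i →
    (signed σ ∖ᵉ ⁅ i , σ i ⁆ᵉ) ∪ᵉ ⁅ j , not (σ j) ⁆ᵉ ≐ almost σ j i
  signed-replace-other {i} {j} j≢i .same-fiber k with k ≟ i | k ≟ j
  ... | yes refl | yes refl = ⊥-elim (j≢i refl)
  ... | yes refl | no _ with σ i
  ...   | true  = refl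
  ...   | false = refl
  signed-replace-other j≢i .same-fiber k | no _ | yes refl with σ k
  ...   | true  = refl
  ...   | false = refl
  signed-replace-other j≢i .same-fiber k | no _ | no _ with σ k
  ...   | true  = refl
  ...   | false = refl

  almost-∖-skewFree : ∀ {p q} → p ≢ q → SkewFree (almost σ p q ∖ᵉ ⁅ p , σ p ⁆ᵉ)
  almost-∖-skewFree {p} {q} p≢q .fiberwise k with k ≟ p | k ≟ q
  ... | yes refl | yes refl = ⊥-elim (p≢q refl)
  ... | yes refl | no _ with σ p
  ...   | true  = refl
  ...   | false = refl
  almost-∖-skewFree p≢q .fiberwise k | no _ | yes refl with σ k
  ...   | true  = refl
  ...   | false = refl
  almost-∖-skewFree p≢q .fiberwise k | no _ | no _ with σ k
  ...   | true  = refl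
  ...   | false = refl

  almost-∪-onlySkew : ∀ {p q} → p ≢ q → OnlySkewAt q (almost σ q p ∪ᵉ ⁅ p , σ p ⁆ᵉ)
  almost-∪-onlySkew {p} {q} p≢q .fiberwise k with k ≟ p | k ≟ q
  ... | yes refl | yes refl = ⊥-elim (p≢q refl)
  ... | yes refl | no _ with σ p
  ...   | true  = refl
  ...   | false = refl
  almost-∪-onlySkew p≢q .fiberwise k | no _ | yes refl with σ k
  ...   | true  = refl
  ...   | false = refl
  almost-∪-onlySkew p≢q .fiberwise k | no _ | no _ with σ k
  ...   | true  = refl
  ...   | false = refl

  almost-replace-same : ∀ {p q} → p ≢ q →
    (almost σ p q ∖ᵉ ⁅ p , σ p ⁆ᵉ) ∪ᵉ ⁅ q , σ q ⁆ᵉ ≐ signed σ △ᵉ (skewᵉ p ∪ᵉ skewᵉ p)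
  almost-replace-same {p} {q} p≢q .same-fiber k with k ≟ p | k ≟ q
  ... | yes refl | yes refl = ⊥-elim (p≢q refl)
  ... | yes refl | no _ with σ p
  ...   | true  = refl
  ...   | false = refl
  almost-replace-same p≢q .same-fiber k | no _ | yes refl with σ k
  ...   | true  = refl
  ...   | false = refl
  almost-replace-same p≢q .same-fiber k | no _ | no _ with σ k
  ...   | true  = refl
  ...   | false = refl

  almost-replace-flip : ∀ {p q} → p ≢ q →
    (almost σ p q ∖ᵉ ⁅ p , σ p ⁆ᵉ) ∪ᵉ ⁅ q , not (σ q) ⁆ᵉ ≐ signed σ △ᵉ (skewᵉ p ∪ᵉ skewᵉ q)
  almost-replace-flip {p} {q} p≢q .same-fiber k with k ≟ p | k ≟ q
  ... | yes refl | yes refl = ⊥-elim (p≢q refl)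
  ... | yes refl | no _ with σ p
  ...   | true  = refl
  ...   | false = refl
  almost-replace-flip p≢q .same-fiber k | no _ | yes refl with σ k
  ...   | true  = refl
  ...   | false = refl
  almost-replace-flip p≢q .same-fiber k | no _ | no _ with σ k
  ...   | true  = refl
  ...   | false = refl

  ∈-almost : ∀ {p q} → p ≢ q → (p , σ p) ∈E ⟦ almost σ p q ⟧
  ∈-almost {p} {q} p≢q = Equivalence.from (∈⟦⟧⇔ (almost σ p q)) fib
    where
    fib : σ p ∈ᶠ (almost σ p q at p) ≡ true
    fib with p ≟ p | p ≟ q
    ... | no p≢p | _       = ⊥-elim (p≢p refl)
    ... | yes _  | yes p≡q = ⊥-elim (p≢q p≡q)
    ... | yes _  | no _ with σ p
    ...   | true  = refl
    ...   | false = refl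

  ∉-almost : ∀ {p q} → (q , σ q) ∉E ⟦ almost σ p q ⟧
  ∉-almost {p} {q} = fib ∘ Equivalence.to (∈⟦⟧⇔ (almost σ p q))
    where
    fib : σ q ∈ᶠ (almost σ p q at q) ≢ true
    fib with q ≟ p | q ≟ q | σ q
    ... | _     | no q≢q | _     = ⊥-elim (q≢q refl)
    ... | yes _ | yes _  | true  = λ ()
    ... | yes _ | yes _  | false = λ ()
    ... | no _  | yes _  | true  = λ ()
    ... | no _  | yes _  | false = λ ()

  almost-difference : ∀ {p q k d} →
    (k , d) ∈E ⟦ almost σ q p ⟧ → (k , d) ∉E ⟦ almost σ p q ⟧ → k ≡ q
  almost-difference {p} {q} {k} {d} k∈ k∉ =
    fib (Equivalence.to (∈⟦⟧⇔ (almost σ q p)) k∈) (k∉ ∘ Equivalence.from (∈⟦⟧⇔ (almost σ p q)))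
    where
    ∉-empty : ∀ d → d ∈ᶠ (false , false) ≢ true
    ∉-empty false ()
    ∉-empty true  ()
    fib : d ∈ᶠ (almost σ q p at k) ≡ true → d ∈ᶠ (almost σ p q at k) ≢ true → k ≡ q
    fib with k ≟ q | k ≟ p
    ... | yes k≡q | _    = λ _ _ → k≡q
    ... | no _    | no _ = λ k∈ k∉ → ⊥-elim (k∉ k∈)
    ... | no _    | yes refl with σ k
    ...   | true  = λ k∈ _ → ⊥-elim (∉-empty d k∈)
    ...   | false = λ k∈ _ → ⊥-elim (∉-empty d k∈)

module _ {n : ℕ} {ℬ : SubE n → Set} (M : IsAntisymmetricMatroid n ℬ) where
  open IsAntisymmetricMatroid M

  almost-swap : ∀ {σ p q} → p ≢ q → ℬ ⟦ almost σ p q ⟧ → ℬ ⟦ almost σ q p ⟧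
  almost-swap {σ} {p} {q} p≢q = Equivalence.to (B2 ⟦ signed σ ⟧ (signed-transversal σ) p q p≢q)

  almost⇒flip : ∀ {σ p q} → p ≢ q → ℬ ⟦ almost σ p q ⟧ →
                ℬ ⟦ signed σ △ᵉ (skewᵉ p ∪ᵉ skewᵉ p) ⟧ ⊎ ℬ ⟦ signed σ △ᵉ (skewᵉ p ∪ᵉ skewᵉ q) ⟧
  almost⇒flip {σ} {p} {q} p≢q β
    with Exch ⟦ almost σ p q ⟧ ⟦ almost σ q p ⟧ (p , σ p) β (almost-swap p≢q β)
              (∈-almost σ p≢q) (∉-almost σ)
              (nSkew⟦⟧≡0 (almost-∖-skewFree σ p≢q)) (nSkew⟦⟧≡1 q (almost-∪-onlySkew σ p≢q))
  ... | (k , c) , f∈ , f∉ , β′ , _ with almost-difference σ f∈ f∉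
  ...   | refl with c Bool.≟ σ q
  ...     | yes refl = inj₁ (subst ℬ (⟦⟧-≡ (almost-replace-same σ p≢q)) β′)
  ...     | no c≢σq with refl ← ¬-not c≢σq = inj₂ (subst ℬ (⟦⟧-≡ (almost-replace-flip σ p≢q)) β′)

  signed-exchange : ∀ {σ τ i} → ℬ ⟦ signed σ ⟧ → ℬ ⟦ signed τ ⟧ → (i , σ i) ∉E ⟦ signed τ ⟧ →
                    ∃ λ j → (j , σ j) ∉E ⟦ signed τ ⟧ × ℬ ⟦ signed σ △ᵉ (skewᵉ i ∪ᵉ skewᵉ j) ⟧
  signed-exchange {σ} {τ} {i} β₁ β₂ x∉
    with Exch ⟦ signed σ ⟧ ⟦ signed τ ⟧ (i , σ i) β₁ β₂ (Equivalence.from ∈-signed refl) x∉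
              (nSkew⟦⟧≡0 (signed-∖-skewFree σ i))
              (nSkew⟦⟧≡1 i (signed-∪-onlySkew τ (x∉ ∘ Equivalence.from ∈-signed)))
  ... | (j , c) , f∈ , f∉ , β , _ with refl ← ¬-not (f∉ ∘ Equivalence.from ∈-signed) | j ≟ i
  ...   | yes refl = i , x∉ , subst ℬ (⟦⟧-≡ (signed-replace-partner σ i)) β
  ...   | no j≢i   = [ (λ β′ → i , x∉ , β′) , (λ β′ → j , y∉ , β′) ] (almost⇒flip (j≢i ∘ sym) βᵢⱼ)
    where
    βᵢⱼ : ℬ ⟦ almost σ i j ⟧
    βᵢⱼ = almost-swap j≢i (subst ℬ (⟦⟧-≡ (signed-replace-other σ j≢i)) β)
    y∉ : (j , σ j) ∉E ⟦ signed τ ⟧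
    y∉ y∈ = not-¬ refl (trans (Equivalence.to ∈-signed y∈) (sym (Equivalence.to ∈-signed f∈)))

  ℬ∩𝒯-nonempty : ∃ (ℬ ∩𝒯)
  ℬ∩𝒯-nonempty with B1
  ... | B , β with ⊆𝒯∪𝒜 B β
  ...   | inj₁ isT = B , β , isT
  ...   | inj₂ isA with almostTransversal⇒almost {X = B} isA
  ...     | σ , p , q , p≢q , refl = [ flipped , flipped ] (almost⇒flip p≢q β)
    where
    flipped : ∀ {j} → ℬ ⟦ signed σ △ᵉ (skewᵉ p ∪ᵉ skewᵉ j) ⟧ → ∃ (ℬ ∩𝒯)
    flipped β′ = _ , β′ , transversal⟦⟧ (flip-transversal σ p _)

  ℬ∩𝒯-exchange : ∀ B₁ B₂ (x : Elem n) → (ℬ ∩𝒯) B₁ → (ℬ ∩𝒯) B₂ → x ∈E B₁ → x ∉E B₂ →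
                 Σ (Elem n) λ y → y ∈E B₁ × y ∉E B₂ × (ℬ ∩𝒯) (B₁ △E (skew (idx x) ∪E skew (idx y)))
  ℬ∩𝒯-exchange B₁ B₂ (i , b) (β₁ , isT₁) (β₂ , isT₂) x∈ x∉
    with transversal⇒signed {X = B₁} isT₁ | transversal⇒signed {X = B₂} isT₂
  ... | σ , refl | τ , refl with refl ← Equivalence.to ∈-signed x∈ | signed-exchange β₁ β₂ x∉
  ... | j , y∉ , β =
    (j , σ j) , Equivalence.from ∈-signed refl , y∉ , β , transversal⟦⟧ (flip-transversal σ i j)

proposition4p3 : (n : ℕ) (ℬ : SubE n → Set) → IsAntisymmetricMatroid n ℬ →
    IsSymmetricMatroid n (ℬ ∩𝒯)
proposition4p3 n ℬ M = record
  { ⊆𝒯       = λ _ → proj₂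
  ; nonempty = ℬ∩𝒯-nonempty M
  ; exch     = ℬ∩𝒯-exchange M
  }
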